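{- Let $v^{(\ell)}_j$ ($\ell \ge 0$, $0 \le j \le 2^{\ell+1}-1$) be the family of rational numbers defined by $v^{(0)}_0 = 1$, $v^{(0)}_1 = 1$, and, for $\ell \ge 1$, $$v^{(\ell)}_0 = 1,\quad v^{(\ell)}_1 = 2,\quad v^{(\ell)}_{2j} = -\frac{v^{(\ell-1)}_j}{v^{(\ell)}_{2j-1}},\quad v^{(\ell)}_{2j+1} = 1 + (-1)^j - v^{(\ell)}_{2j}\qquad (1 \le j \le 2^\ell - 1).$$ Then all these numbers are well defined and $\nu_2(v^{(\ell)}_j)$ equals: $1$ if $\ell \ge 1$ and $j = 1$; $-1$ if $\ell \ge 1$ and $j \in \{2^\ell, 2^\ell + 1\}$; $0$ otherwise. As a consequence, $v^{(\ell)}_j \ne 0$ for all $\ell \ge 0$ and $0 \le j \le 2^{\ell+1}-1$.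
   Context: For a nonzero rational number $x$, $\nu_2(x)$ denotes its $2$-adic valuation (the exponent of $2$ in its prime factorization), and $\nu_2(0) = +\infty$. -}

module Defs where

open import Data.Nat as ℕ using (ℕ; zero; suc; _<_; _<ᵇ_; _%_; _/_; _^_)
open import Data.Nat.DivMod using ()
open import Data.Integer as ℤ using (ℤ; +_; ∣_∣)
open import Data.Rational using (ℚ; 0ℚ; 1ℚ; _÷_; -_; _+_; _-_; ≢-nonZero; ↥_; ↧ₙ_)
open import Data.Rational.Properties using (_≟_)
open import Data.Bool using (Bool; true; false; if_then_else_)
open import Data.Maybe using (Maybe; just; nothing; _>>=_)
open import Data.Product using (_×_; _,_; proj₁; proj₂)
open import Relation.Nullary using (yes; no)

2ℚ : ℚ
2ℚ = 1ℚ + 1ℚ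

neg1^ : ℕ → ℚ
neg1^ zero = 1ℚ
neg1^ (suc j) = - (neg1^ j)

safeDiv : ℚ → ℚ → Maybe ℚ
safeDiv p q with q ≟ 0ℚ
... | yes _ = nothing
... | no q≢0 = just (_÷_ p q {{≢-nonZero q≢0}})

-- v ℓ j = just v^{(ℓ)}_j when it is well defined (all divisions by nonzero numbers,
-- 0 ≤ j ≤ 2^{ℓ+1}-1), and nothing otherwise.
-- pairs ℓ j = just (v^{(ℓ+1)}_{2j} , v^{(ℓ+1)}_{2j+1}) for 0 ≤ j ≤ 2^{ℓ+1} - 1.
mutual
  v : ℕ → ℕ → Maybe ℚ
  v zero zero = just 1ℚ
  v zero (suc zero) = just 1ℚ
  v zero (suc (suc _)) = nothing
  v (suc ℓ) j = pairs ℓ (j / 2) >>= λ p →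
    if j % 2 ℕ.≡ᵇ 0 then just (proj₁ p) else just (proj₂ p)

  pairs : ℕ → ℕ → Maybe (ℚ × ℚ)
  pairs ℓ zero = just (1ℚ , 2ℚ)
  pairs ℓ (suc j) =
    if suc j <ᵇ 2 ^ suc ℓ
    then (pairs ℓ j >>= λ p → v ℓ (suc j) >>= λ c → safeDiv (- c) (proj₂ p) >>= λ d →
            just (d , (1ℚ + neg1^ (suc j)) - d))
    else nothing

-- 2-adic valuation of a natural number (exponent of 2 in n; 0 for n = 0 by convention,
-- never used at 0). Computed with fuel n, which suffices since n halves each step.
ν₂ℕ-go : ℕ → ℕ → ℕ
ν₂ℕ-go zero n = 0
ν₂ℕ-go (suc f) zero = 0
ν₂ℕ-go (suc f) (suc n) =
  if suc n % 2 ℕ.≡ᵇ 0 then suc (ν₂ℕ-go f (suc n / 2)) else 0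

ν₂ℕ : ℕ → ℕ
ν₂ℕ n = ν₂ℕ-go n n

ν₂ : ℚ → ℤ
ν₂ q = + ν₂ℕ ∣ ↥ q ∣ ℤ.- + ν₂ℕ (↧ₙ q)

-- Every entry is of one of three kinds: v_1 = 2, a 2-adic unit (odd numerator and
-- denominator), or half a 2-adic unit (ν₂ = -1).  Units are closed under products, inverses,
-- negation and adding a rational with even numerator, so ν₂(v_{2j}) = ν₂(v^{(ℓ-1)}_j) - ν₂(v_{2j-1}),
-- and v_{2j+1} = (2 or 0) - v_{2j} has the kind of v_{2j}.  Going up in j, each quotient is
-- unit/unit except at the two middle entries of level ℓ-1 (ν₂ = -1): dividing the first by a
-- unit makes v_{2^ℓ} and v_{2^ℓ+1} halves of units, and dividing the second by v_{2^ℓ+1}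
-- returns to units.  The chain starts at v_2 = -v^{(ℓ-1)}_1 / 2, which is -1/2 for ℓ = 1
-- (the middle entry) and -1 otherwise.
module Submission where

open import Data.Bool using (if_then_else_)
open import Data.Bool.Properties using (T-≡)
open import Data.Empty using (⊥-elim)
open import Data.Integer as ℤ using (ℤ; +_; -[1+_]; ∣_∣)
import Data.Integer.Properties as ℤ
open import Data.Integer.Divisibility.Signed
open import Data.Maybe using (just)
open import Data.Nat as ℕ using (ℕ; zero; suc; _<_; _≤_; _^_; z≤n; s≤s)
import Data.Nat.Coprimality as ℕ
import Data.Nat.Divisibility as ℕ
import Data.Nat.DivMod as ℕ
open import Data.Nat.Primality using (prime[2]; euclidsLemma)
import Data.Nat.Properties as ℕ
open import Data.Product using (Σ; _×_; _,_; proj₁; proj₂)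
open import Data.Rational as ℚ using (ℚ; mkℚ; ↥_; ↧_; ↧ₙ_; 0ℚ; 1ℚ; -_; _*_; _+_; 1/_)
import Data.Rational.Properties as ℚ
open import Data.Sum using (_⊎_; inj₁; inj₂)
open import Function using (_∘_)
open import Function.Bundles using (Equivalence)
open import Relation.Nullary using (¬_; yes; no)
open import Relation.Nullary.Decidable using (_×-dec_; _⊎-dec_)
open import Relation.Binary.PropositionalEquality

open import Defs

Odd : ℤ → Set
Odd a = ¬ (+ 2 ∣ a)

odd-1 : Odd (+ 1)
odd-1 2∣1 with ℕ.∣1⇒≡1 (∣⇒∣ᵤ 2∣1)
... | ()

∣-*-oddˡ : ∀ {a b} → Odd a → + 2 ∣ a ℤ.* b → + 2 ∣ b
∣-*-oddˡ {a} {b} oa 2∣ab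
  with euclidsLemma ∣ a ∣ ∣ b ∣ prime[2] (subst (2 ℕ.∣_) (ℤ.abs-* a b) (∣⇒∣ᵤ 2∣ab))
... | inj₁ 2∣a = ⊥-elim (oa (∣ᵤ⇒∣ 2∣a))
... | inj₂ 2∣b = ∣ᵤ⇒∣ 2∣b

odd-* : ∀ {a b} → Odd a → Odd b → Odd (a ℤ.* b)
odd-* oa ob 2∣ab = ob (∣-*-oddˡ oa 2∣ab)

odd-*⇒oddˡ : ∀ {a} b → Odd (a ℤ.* b) → Odd a
odd-*⇒oddˡ b o 2∣a = o (∣m⇒∣m*n b 2∣a)

odd-*⇒oddʳ : ∀ a {b} → Odd (a ℤ.* b) → Odd b
odd-*⇒oddʳ a o 2∣b = o (∣n⇒∣m*n a 2∣b)

odd-neg : ∀ {a} → Odd a → Odd (ℤ.- a)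
odd-neg {a} o 2∣-a = o (subst (+ 2 ∣_) (ℤ.neg-involutive a) (∣m⇒∣-m 2∣-a))

even+odd : ∀ {a b} → + 2 ∣ a → Odd b → Odd (a ℤ.+ b)
even+odd 2∣a ob 2∣a+b = ob (∣m+n∣m⇒∣n 2∣a+b 2∣a)

odd⇒∤∣∣ : ∀ {a} → Odd a → ¬ 2 ℕ.∣ ∣ a ∣
odd⇒∤∣∣ odd 2∣ = odd (∣ᵤ⇒∣ 2∣)

even-↥⇒odd-↧ : ∀ q → + 2 ∣ ↥ q → Odd (↧ q)
even-↥⇒odd-↧ (mkℚ n d coprime) 2∣n 2∣d with ℕ.recompute coprime (∣⇒∣ᵤ 2∣n , ∣⇒∣ᵤ 2∣d)
... | ()

even-↧⇒odd-↥ : ∀ q → + 2 ∣ ↧ q → Odd (↥ q)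
even-↧⇒odd-↥ q 2∣d 2∣n = even-↥⇒odd-↧ q 2∣n 2∣d

-- Rationals of 2-adic valuation 0 and -1

record TwoAdicUnit (q : ℚ) : Set where
  constructor _,_
  field
    odd-↥ : Odd (↥ q)
    odd-↧ : Odd (↧ q)

record HalfOfUnit (q : ℚ) : Set where
  constructor halve
  field twice-unit : TwoAdicUnit (2ℚ * q)

unit⇒≢0 : ∀ {q} → TwoAdicUnit q → q ≢ 0ℚ
unit⇒≢0 (odd , _) refl = odd (divides (+ 0) refl)

halfOfUnit⇒≢0 : ∀ {q} → HalfOfUnit q → q ≢ 0ℚ
halfOfUnit⇒≢0 (halve u) refl = unit⇒≢0 u refl

unit-1 : TwoAdicUnit 1ℚ
unit-1 = odd-1 , odd-1

unit-neg : ∀ {q} → TwoAdicUnit q → TwoAdicUnit (- q)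
unit-neg {q} (on , od) = subst Odd (sym (ℚ.↥-neg q)) (odd-neg on) , subst Odd (sym (ℚ.↧-neg q)) od

unit-* : ∀ {p q} → TwoAdicUnit p → TwoAdicUnit q → TwoAdicUnit (p * q)
unit-* {p} {q} (onp , odp) (onq , odq) =
  odd-*⇒oddˡ _ (subst Odd (sym (ℚ.↥-* p q)) (odd-* onp onq)) ,
  odd-*⇒oddˡ _ (subst Odd (sym (ℚ.↧-* p q)) (odd-* odp odq))

unit-1/ : ∀ {q} .{{_ : ℚ.NonZero q}} → TwoAdicUnit q → TwoAdicUnit (1/ q)
unit-1/ {mkℚ ℤ.+[1+ n ] d _} (on , od) = od , on
unit-1/ {mkℚ -[1+ n ] d _}   (on , od) = odd-neg od , odd-neg on

unit-+ : ∀ {p q} → + 2 ∣ ↥ p → TwoAdicUnit q → TwoAdicUnit (p + q)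
unit-+ {p} {q} 2∣↥p (onq , odq) =
  odd-*⇒oddˡ _ (subst Odd (sym (ℚ.↥-+ p q)) (even+odd (∣m⇒∣m*n (↧ q) 2∣↥p) (odd-* onq odp))) ,
  odd-*⇒oddˡ _ (subst Odd (sym (ℚ.↧-+ p q)) (odd-* odp odq))
  where odp = even-↥⇒odd-↧ p 2∣↥p

*≡⇒≡*1/ : ∀ {d x} y .{{_ : ℚ.NonZero y}} → d * y ≡ x → d ≡ x * 1/ y
*≡⇒≡*1/ {d} {x} y dy≡x = begin
  d                ≡⟨ ℚ.*-identityʳ d ⟨
  d * 1ℚ           ≡⟨ cong (d *_) (ℚ.*-inverseʳ y) ⟨
  d * (y * 1/ y)   ≡⟨ ℚ.*-assoc d y (1/ y) ⟨
  d * y * 1/ y     ≡⟨ cong (_* 1/ y) dy≡x ⟩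
  x * 1/ y         ∎
  where open ≡-Reasoning

unit-÷ : ∀ {d x y} → d * y ≡ x → TwoAdicUnit x → TwoAdicUnit y → TwoAdicUnit d
unit-÷ {y = y} dy≡x ux uy = subst TwoAdicUnit (sym (*≡⇒≡*1/ y dy≡x)) (unit-* ux (unit-1/ uy))
  where instance _ = ℚ.≢-nonZero (unit⇒≢0 uy)

halfOfUnit-neg : ∀ {q} → HalfOfUnit q → HalfOfUnit (- q)
halfOfUnit-neg {q} (halve u) = halve (subst TwoAdicUnit (ℚ.neg-distribʳ-* 2ℚ q) (unit-neg u))

halfOfUnit-+ : ∀ {p q} → + 2 ∣ ↥ (2ℚ * p) → HalfOfUnit q → HalfOfUnit (p + q)
halfOfUnit-+ {p} {q} 2∣↥2p (halve u) =
  halve (subst TwoAdicUnit (sym (ℚ.*-distribˡ-+ 2ℚ p q)) (unit-+ {2ℚ * p} 2∣↥2p u))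

halfOfUnit-÷2 : ∀ {d x} → d * 2ℚ ≡ x → TwoAdicUnit x → HalfOfUnit d
halfOfUnit-÷2 {d} d2≡x = halve ∘ subst TwoAdicUnit (trans (sym d2≡x) (ℚ.*-comm d 2ℚ))

halfOfUnit-÷ : ∀ {d x y} → d * y ≡ x → HalfOfUnit x → TwoAdicUnit y → HalfOfUnit d
halfOfUnit-÷ {d} {x} {y} dy≡x (halve ux) uy = halve (unit-÷ (begin
  2ℚ * d * y     ≡⟨ ℚ.*-assoc 2ℚ d y ⟩
  2ℚ * (d * y)   ≡⟨ cong (2ℚ *_) dy≡x ⟩
  2ℚ * x         ∎) ux uy)
  where open ≡-Reasoning

halfOfUnit-÷halfOfUnit : ∀ {d x y} → d * y ≡ x → HalfOfUnit x → HalfOfUnit y → TwoAdicUnit d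
halfOfUnit-÷halfOfUnit {d} {x} {y} dy≡x (halve ux) (halve uy) = unit-÷ (begin
  d * (2ℚ * y)   ≡⟨ ℚ.*-assoc d 2ℚ y ⟨
  d * 2ℚ * y     ≡⟨ cong (_* y) (ℚ.*-comm d 2ℚ) ⟩
  2ℚ * d * y     ≡⟨ ℚ.*-assoc 2ℚ d y ⟩
  2ℚ * (d * y)   ≡⟨ cong (2ℚ *_) dy≡x ⟩
  2ℚ * x         ∎) ux uy
  where open ≡-Reasoning

neg1^≡±1 : ∀ n → neg1^ n ≡ 1ℚ ⊎ neg1^ n ≡ - 1ℚ
neg1^≡±1 zero    = inj₁ refl
neg1^≡±1 (suc n) with neg1^≡±1 n
... | inj₁ ≡1  = inj₂ (cong -_ ≡1)
... | inj₂ ≡-1 = inj₁ (cong -_ ≡-1)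

unit-alternating : ∀ n {d} → TwoAdicUnit d → TwoAdicUnit ((1ℚ + neg1^ n) ℚ.- d)
unit-alternating n u with neg1^≡±1 n
... | inj₁ ≡1  rewrite ≡1  = unit-+ {1ℚ + 1ℚ} (divides (+ 1) refl) (unit-neg u)
... | inj₂ ≡-1 rewrite ≡-1 = unit-+ {1ℚ + - 1ℚ} (divides (+ 0) refl) (unit-neg u)

halfOfUnit-alternating : ∀ n {d} → HalfOfUnit d → HalfOfUnit ((1ℚ + neg1^ n) ℚ.- d)
halfOfUnit-alternating n u with neg1^≡±1 n
... | inj₁ ≡1  rewrite ≡1  = halfOfUnit-+ {1ℚ + 1ℚ} (divides (+ 2) refl) (halfOfUnit-neg u)
... | inj₂ ≡-1 rewrite ≡-1 = halfOfUnit-+ {1ℚ + - 1ℚ} (divides (+ 0) refl) (halfOfUnit-neg u)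

odd⇒%2≡1 : ∀ {n} → ¬ 2 ℕ.∣ n → n ℕ.% 2 ≡ 1
odd⇒%2≡1 {n} odd with n ℕ.% 2 in n%2 | ℕ.m%n<n n 2
... | 0           | _             = ⊥-elim (odd (ℕ.m%n≡0⇒n∣m n 2 n%2))
... | 1           | _             = refl
... | suc (suc _) | s≤s (s≤s ())

ν₂ℕ-go-odd : ∀ f {n} → ¬ 2 ℕ.∣ n → ν₂ℕ-go f n ≡ 0
ν₂ℕ-go-odd zero    _   = refl
ν₂ℕ-go-odd (suc f) {zero}  odd = refl
ν₂ℕ-go-odd (suc f) {suc n} odd rewrite odd⇒%2≡1 odd = refl

ν₂ℕ-go-even : ∀ f n → 2 ℕ.∣ suc n → ν₂ℕ-go (suc f) (suc n) ≡ suc (ν₂ℕ-go f (suc n ℕ./ 2))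
ν₂ℕ-go-even f n 2∣ rewrite ℕ.n∣m⇒m%n≡0 (suc n) 2 2∣ = refl

ν₂ℕ-odd : ∀ {n} → ¬ 2 ℕ.∣ n → ν₂ℕ n ≡ 0
ν₂ℕ-odd {n} = ν₂ℕ-go-odd n

ν₂ℕ-odd*2 : ∀ {m} → ¬ 2 ℕ.∣ m → ν₂ℕ (m ℕ.* 2) ≡ 1
ν₂ℕ-odd*2 {zero}  odd = ⊥-elim (odd (2 ℕ.∣0))
ν₂ℕ-odd*2 {suc m} odd = begin
  ν₂ℕ (suc m ℕ.* 2)                  ≡⟨ ν₂ℕ-go-even f f (ℕ.divides (suc m) refl) ⟩
  suc (ν₂ℕ-go f (suc m ℕ.* 2 ℕ./ 2)) ≡⟨ cong (suc ∘ ν₂ℕ-go f) (ℕ.m*n/n≡m (suc m) 2) ⟩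
  suc (ν₂ℕ-go f (suc m))             ≡⟨ cong suc (ν₂ℕ-go-odd f odd) ⟩
  1                                  ∎
  where
  f = suc (m ℕ.* 2)
  open ≡-Reasoning

ν₂-unit : ∀ {q} → TwoAdicUnit q → ν₂ q ≡ + 0
ν₂-unit (odd-↥ , odd-↧) =
  cong₂ (λ a b → + a ℤ.- + b) (ν₂ℕ-odd (odd⇒∤∣∣ odd-↥)) (ν₂ℕ-odd (odd⇒∤∣∣ odd-↧))

-- Write 2q = N/D in lowest terms, so N g = 2 ↥q and D g = ↧q for g = gcd(2 ↥q, ↧q).
-- As N is odd, g is even; hence ↧q is even, ↥q is odd, and g/2 is odd.
halfOfUnit-shape : ∀ {q} → HalfOfUnit q → Odd (↥ q) × Σ ℤ λ m → Odd m × ↧ q ≡ m ℤ.* + 2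
halfOfUnit-shape {q} (halve (odd-N , odd-D)) = shape (ℚ.↥-* 2ℚ q) (ℚ.↧-* 2ℚ q)
  where
  N = ↥ (2ℚ * q)
  D = ↧ (2ℚ * q)
  shape : ∀ {g} → N ℤ.* g ≡ + 2 ℤ.* ↥ q → D ℤ.* g ≡ + 1 ℤ.* ↧ q →
          Odd (↥ q) × Σ ℤ λ m → Odd m × ↧ q ≡ m ℤ.* + 2
  shape Ng≡2↥q Dg≡↧q with ∣-*-oddˡ odd-N (divides (↥ q) (trans Ng≡2↥q (ℤ.*-comm (+ 2) (↥ q))))
  ... | divides h refl = odd-↥q , D ℤ.* h , odd-* odd-D odd-h , ↧q≡Dh*2
    where
    ↧q≡Dh*2 : ↧ q ≡ D ℤ.* h ℤ.* + 2
    ↧q≡Dh*2 = begin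
      ↧ q                     ≡⟨ ℤ.*-identityˡ (↧ q) ⟨
      + 1 ℤ.* ↧ q             ≡⟨ Dg≡↧q ⟨
      D ℤ.* (h ℤ.* + 2)       ≡⟨ ℤ.*-assoc D h (+ 2) ⟨
      D ℤ.* h ℤ.* + 2         ∎
      where open ≡-Reasoning
    odd-↥q : Odd (↥ q)
    odd-↥q = even-↧⇒odd-↥ q (divides (D ℤ.* h) ↧q≡Dh*2)
    Nh≡↥q : N ℤ.* h ≡ ↥ q
    Nh≡↥q = ℤ.*-cancelʳ-≡ _ _ (+ 2) (begin
      N ℤ.* h ℤ.* + 2         ≡⟨ ℤ.*-assoc N h (+ 2) ⟩
      N ℤ.* (h ℤ.* + 2)       ≡⟨ Ng≡2↥q ⟩
      + 2 ℤ.* ↥ q             ≡⟨ ℤ.*-comm (+ 2) (↥ q) ⟩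
      ↥ q ℤ.* + 2             ∎)
      where open ≡-Reasoning
    odd-h : Odd h
    odd-h = odd-*⇒oddʳ N (subst Odd (sym Nh≡↥q) odd-↥q)

ν₂-halfOfUnit : ∀ {q} → HalfOfUnit q → ν₂ q ≡ -[1+ 0 ]
ν₂-halfOfUnit {q} u with halfOfUnit-shape u
... | odd-↥ , m , odd-m , ↧q≡m*2 = cong₂ (λ a b → + a ℤ.- + b) (ν₂ℕ-odd (odd⇒∤∣∣ odd-↥)) ν₂ℕ-↧≡1
  where
  ν₂ℕ-↧≡1 : ν₂ℕ (↧ₙ q) ≡ 1
  ν₂ℕ-↧≡1 = trans (cong ν₂ℕ (trans (cong ∣_∣ ↧q≡m*2) (ℤ.abs-* m (+ 2)))) (ν₂ℕ-odd*2 (odd⇒∤∣∣ odd-m))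

safeDiv-just : ∀ x {y} → y ≢ 0ℚ → Σ ℚ λ d → safeDiv x y ≡ just d × d * y ≡ x
safeDiv-just x {y} y≢0 with y ℚ.≟ 0ℚ
... | yes y≡0  = ⊥-elim (y≢0 y≡0)
... | no  y≢0′ = x ℚ.÷ y , refl , x÷y*y≡x
  where
  instance _ = ℚ.≢-nonZero y≢0′
  x÷y*y≡x : x ℚ.÷ y * y ≡ x
  x÷y*y≡x = begin
    x * 1/ y * y     ≡⟨ ℚ.*-assoc x (1/ y) y ⟩
    x * (1/ y * y)   ≡⟨ cong (x *_) (ℚ.*-inverseˡ y) ⟩
    x * 1ℚ           ≡⟨ ℚ.*-identityʳ x ⟩
    x                ∎
    where open ≡-Reasoning

pairs-suc : ∀ {ℓ i d e c d′} → suc i < 2 ^ suc ℓ → pairs ℓ i ≡ just (d , e) → v ℓ (suc i) ≡ just c →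
            safeDiv (- c) e ≡ just d′ → pairs ℓ (suc i) ≡ just (d′ , (1ℚ + neg1^ (suc i)) ℚ.- d′)
pairs-suc {ℓ} {i} i+1<2^ℓ⁺¹ pairs≡ v≡ safeDiv≡
  rewrite Equivalence.to T-≡ (ℕ.<⇒<ᵇ i+1<2^ℓ⁺¹) | pairs≡ | v≡ | safeDiv≡ = refl

2*i%2≡0 : ∀ i → 2 ℕ.* i ℕ.% 2 ≡ 0
2*i%2≡0 i = trans (cong (ℕ._% 2) (ℕ.*-comm 2 i)) (ℕ.m*n%n≡0 i 2)

1+2*i%2≡1 : ∀ i → suc (2 ℕ.* i) ℕ.% 2 ≡ 1
1+2*i%2≡1 i = trans (cong (λ k → suc k ℕ.% 2) (ℕ.*-comm 2 i)) (ℕ.[m+kn]%n≡m%n 1 i 2)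

2*i/2≡i : ∀ i → 2 ℕ.* i ℕ./ 2 ≡ i
2*i/2≡i i = trans (cong (ℕ._/ 2) (ℕ.*-comm 2 i)) (ℕ.m*n/n≡m i 2)

1+2*i/2≡i : ∀ i → suc (2 ℕ.* i) ℕ./ 2 ≡ i
1+2*i/2≡i i = trans (ℕ.+-distrib-/-∣ʳ 1 (ℕ.divides i (ℕ.*-comm 2 i))) (2*i/2≡i i)

v-suc : ∀ {ℓ} j {i r d e} → j ℕ./ 2 ≡ i → j ℕ.% 2 ≡ r → pairs ℓ i ≡ just (d , e) →
        v (suc ℓ) j ≡ (if r ℕ.≡ᵇ 0 then just d else just e)
v-suc j refl refl pairs≡ rewrite pairs≡ = refl

v-even : ∀ {ℓ i d e} → pairs ℓ i ≡ just (d , e) → v (suc ℓ) (2 ℕ.* i) ≡ just d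
v-even {i = i} = v-suc (2 ℕ.* i) (2*i/2≡i i) (2*i%2≡0 i)

v-odd : ∀ {ℓ i d e} → pairs ℓ i ≡ just (d , e) → v (suc ℓ) (suc (2 ℕ.* i)) ≡ just e
v-odd {i = i} = v-suc (suc (2 ℕ.* i)) (1+2*i/2≡i i) (1+2*i%2≡1 i)

even-or-odd : ∀ j → Σ ℕ λ i → j ≡ 2 ℕ.* i ⊎ j ≡ suc (2 ℕ.* i)
even-or-odd zero = 0 , inj₁ refl
even-or-odd (suc j) with even-or-odd j
... | i , inj₁ refl = i , inj₂ refl
... | i , inj₂ refl = suc i , inj₁ (cong suc (sym (ℕ.+-suc i (i ℕ.+ 0))))

AtOne : ℕ → ℕ → Set
AtOne ℓ j = 1 ≤ ℓ × j ≡ 1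

AtMiddle : ℕ → ℕ → Set
AtMiddle ℓ j = 1 ≤ ℓ × (j ≡ 2 ^ ℓ ⊎ j ≡ 2 ^ ℓ ℕ.+ 1)

record Shape (ℓ j : ℕ) (q : ℚ) : Set where
  field
    at-one    : AtOne ℓ j → q ≡ 2ℚ
    at-middle : AtMiddle ℓ j → HalfOfUnit q
    elsewhere : ¬ AtOne ℓ j → ¬ AtMiddle ℓ j → TwoAdicUnit q
open Shape

-- The common shape of v^{(ℓ+1)}_{2i} and v^{(ℓ+1)}_{2i+1} for i ≥ 1.
PairShape : ℕ → ℕ → ℚ → Set
PairShape ℓ i q = (i ≡ 2 ^ ℓ → HalfOfUnit q) × (i ≢ 2 ^ ℓ → TwoAdicUnit q)

2^ℓ≢0 : ∀ ℓ → 2 ^ ℓ ≢ 0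
2^ℓ≢0 ℓ = ℕ.m<n⇒n≢0 (ℕ.m^n>0 2 ℓ)

atOne-even : ∀ {ℓ} i → ¬ AtOne ℓ (2 ℕ.* i)
atOne-even i (_ , 2i≡1) = ℕ.even≢odd i 0 2i≡1

atMiddle-even⇒ : ∀ {ℓ} i → AtMiddle (suc ℓ) (2 ℕ.* i) → i ≡ 2 ^ ℓ
atMiddle-even⇒ {ℓ} i (_ , inj₁ 2i≡2^ℓ⁺¹)   = ℕ.*-cancelˡ-≡ i (2 ^ ℓ) 2 2i≡2^ℓ⁺¹
atMiddle-even⇒ {ℓ} i (_ , inj₂ 2i≡2^ℓ⁺¹+1) =
  ⊥-elim (ℕ.even≢odd i (2 ^ ℓ) (trans 2i≡2^ℓ⁺¹+1 (ℕ.+-comm _ 1)))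

atMiddle-even⇐ : ∀ {ℓ} i → i ≡ 2 ^ ℓ → AtMiddle (suc ℓ) (2 ℕ.* i)
atMiddle-even⇐ i refl = s≤s z≤n , inj₁ refl

atOne-odd⇒ : ∀ {ℓ} i → AtOne ℓ (suc (2 ℕ.* i)) → i ≡ 0
atOne-odd⇒ i (_ , 1+2i≡1) = ℕ.*-cancelˡ-≡ i 0 2 (ℕ.suc-injective 1+2i≡1)

atMiddle-odd⇒ : ∀ {ℓ} i → AtMiddle (suc ℓ) (suc (2 ℕ.* i)) → i ≡ 2 ^ ℓ
atMiddle-odd⇒ {ℓ} i (_ , inj₁ 1+2i≡2^ℓ⁺¹)   = ⊥-elim (ℕ.even≢odd (2 ^ ℓ) i (sym 1+2i≡2^ℓ⁺¹))
atMiddle-odd⇒ {ℓ} i (_ , inj₂ 1+2i≡2^ℓ⁺¹+1) =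
  ℕ.*-cancelˡ-≡ i (2 ^ ℓ) 2 (ℕ.suc-injective (trans 1+2i≡2^ℓ⁺¹+1 (ℕ.+-comm _ 1)))

atMiddle-odd⇐ : ∀ {ℓ} i → i ≡ 2 ^ ℓ → AtMiddle (suc ℓ) (suc (2 ℕ.* i))
atMiddle-odd⇐ i refl = s≤s z≤n , inj₂ (ℕ.+-comm 1 _)

shape-even : ∀ {ℓ i q} → PairShape ℓ i q → Shape (suc ℓ) (2 ℕ.* i) q
shape-even {i = i} (half , unit) = record
  { at-one    = λ one → ⊥-elim (atOne-even i one)
  ; at-middle = λ mid → half (atMiddle-even⇒ i mid)
  ; elsewhere = λ _ ¬mid → unit (¬mid ∘ atMiddle-even⇐ i)
  }

shape-odd : ∀ {ℓ i q} → i ≢ 0 → PairShape ℓ i q → Shape (suc ℓ) (suc (2 ℕ.* i)) q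
shape-odd {i = i} i≢0 (half , unit) = record
  { at-one    = λ one → ⊥-elim (i≢0 (atOne-odd⇒ i one))
  ; at-middle = λ mid → half (atMiddle-odd⇒ i mid)
  ; elsewhere = λ _ ¬mid → unit (¬mid ∘ atMiddle-odd⇐ i)
  }

shape-odd⁻¹ : ∀ {ℓ i q} → i ≢ 0 → Shape (suc ℓ) (suc (2 ℕ.* i)) q → PairShape ℓ i q
shape-odd⁻¹ {i = i} i≢0 s =
  (λ i≡2^ℓ → at-middle s (atMiddle-odd⇐ i i≡2^ℓ)) ,
  (λ i≢2^ℓ → elsewhere s (i≢0 ∘ atOne-odd⇒ i) (i≢2^ℓ ∘ atMiddle-odd⇒ i))

shape-one : ∀ {ℓ} → Shape (suc ℓ) 1 2ℚ
shape-one {ℓ} = record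
  { at-one    = λ _ → refl
  ; at-middle = λ mid → ⊥-elim (2^ℓ≢0 ℓ (sym (atMiddle-odd⇒ 0 mid)))
  ; elsewhere = λ ¬one _ → ⊥-elim (¬one (s≤s z≤n , refl))
  }

shape⇒≢0 : ∀ {ℓ j q} → Shape ℓ j q → q ≢ 0ℚ
shape⇒≢0 {ℓ} {j} s
  with (1 ℕ.≤? ℓ) ×-dec (j ℕ.≟ 1) | (1 ℕ.≤? ℓ) ×-dec ((j ℕ.≟ 2 ^ ℓ) ⊎-dec (j ℕ.≟ 2 ^ ℓ ℕ.+ 1))
... | yes one | _        = λ q≡0 → 2ℚ≢0 (trans (sym (at-one s one)) q≡0)
  where 2ℚ≢0 : 2ℚ ≢ 0ℚ
        2ℚ≢0 ()
... | no ¬one | yes mid  = halfOfUnit⇒≢0 (at-middle s mid)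
... | no ¬one | no ¬mid  = unit⇒≢0 (elsewhere s ¬one ¬mid)

-- d = - c / e is the new entry v^{(ℓ+1)}_{2i+2}, with c = v^{(ℓ)}_{i+1} and e = v^{(ℓ+1)}_{2i+1}.
pairShape-quotient : ∀ {ℓ i c e d} → suc i < 2 ^ suc ℓ →
                     Shape ℓ (suc i) c → Shape (suc ℓ) (suc (2 ℕ.* i)) e →
                     d * e ≡ - c → PairShape ℓ (suc i) d
pairShape-quotient {zero} {zero} {c} {d = d} _ sc se de≡-c =
  (λ _ → halfOfUnit-÷2 (subst (λ e → d * e ≡ - c) (at-one se (s≤s z≤n , refl)) de≡-c)
                       (unit-neg (elsewhere sc (λ ()) (λ ())))) ,
  (λ 1≢1 → ⊥-elim (1≢1 refl))
pairShape-quotient {zero} {suc i} (s≤s (s≤s ())) _ _ _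
pairShape-quotient {suc ℓ} {zero} {d = d} _ sc se de≡-c =
  (λ 1≡2^ℓ⁺¹ → ⊥-elim (ℕ.even≢odd (2 ^ ℓ) 0 (sym 1≡2^ℓ⁺¹))) ,
  (λ _ → subst TwoAdicUnit (sym (*≡⇒≡*1/ 2ℚ d*2≡-2)) (unit-neg unit-1))
  where
  d*2≡-2 : d * 2ℚ ≡ - 2ℚ
  d*2≡-2 = subst₂ (λ e c → d * e ≡ - c)
                  (at-one se (s≤s z≤n , refl)) (at-one sc (s≤s z≤n , refl)) de≡-c
pairShape-quotient {suc ℓ} {suc i} {c} {e} _ sc se de≡-c
  with suc (suc i) ℕ.≟ 2 ^ suc ℓ | suc i ℕ.≟ 2 ^ suc ℓ
... | yes i+2≡2^ℓ⁺¹ | _ =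
  (λ _ → halfOfUnit-÷ de≡-c (halfOfUnit-neg half-c) unit-e) ,
  (λ i+2≢2^ℓ⁺¹ → ⊥-elim (i+2≢2^ℓ⁺¹ i+2≡2^ℓ⁺¹))
  where
  half-c : HalfOfUnit c
  half-c = at-middle sc (s≤s z≤n , inj₁ i+2≡2^ℓ⁺¹)
  unit-e : TwoAdicUnit e
  unit-e = proj₂ (shape-odd⁻¹ (λ ()) se) (ℕ.1+n≢n ∘ trans i+2≡2^ℓ⁺¹ ∘ sym)
... | no i+2≢2^ℓ⁺¹ | yes i+1≡2^ℓ⁺¹ =
  (λ i+2≡2^ℓ⁺¹ → ⊥-elim (i+2≢2^ℓ⁺¹ i+2≡2^ℓ⁺¹)) ,
  (λ _ → halfOfUnit-÷halfOfUnit de≡-c (halfOfUnit-neg half-c) half-e)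
  where
  half-c : HalfOfUnit c
  half-c = at-middle sc (s≤s z≤n , inj₂ (trans (cong suc i+1≡2^ℓ⁺¹) (ℕ.+-comm 1 _)))
  half-e : HalfOfUnit e
  half-e = proj₁ (shape-odd⁻¹ (λ ()) se) i+1≡2^ℓ⁺¹
... | no i+2≢2^ℓ⁺¹ | no i+1≢2^ℓ⁺¹ =
  (λ i+2≡2^ℓ⁺¹ → ⊥-elim (i+2≢2^ℓ⁺¹ i+2≡2^ℓ⁺¹)) ,
  (λ _ → unit-÷ de≡-c (unit-neg (elsewhere sc (λ ()) ¬mid)) (proj₂ (shape-odd⁻¹ (λ ()) se) i+1≢2^ℓ⁺¹))
  where
  ¬mid : ¬ AtMiddle (suc ℓ) (suc (suc i))
  ¬mid (_ , inj₁ i+2≡2^ℓ⁺¹)   = i+2≢2^ℓ⁺¹ i+2≡2^ℓ⁺¹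
  ¬mid (_ , inj₂ i+2≡2^ℓ⁺¹+1) = i+1≢2^ℓ⁺¹ (ℕ.suc-injective (trans i+2≡2^ℓ⁺¹+1 (ℕ.+-comm _ 1)))

pairShape-alternating : ∀ {ℓ i d} n → PairShape ℓ i d → PairShape ℓ i ((1ℚ + neg1^ n) ℚ.- d)
pairShape-alternating n (half , unit) =
  (halfOfUnit-alternating n ∘ half) , (unit-alternating n ∘ unit)

LevelInvariant : ℕ → Set
LevelInvariant ℓ = ∀ j → j < 2 ^ suc ℓ → Σ ℚ λ q → v ℓ j ≡ just q × Shape ℓ j q

PairsInvariant : ℕ → Set
PairsInvariant ℓ = ∀ i → i < 2 ^ suc ℓ → Σ ℚ λ d → Σ ℚ λ e →
  pairs ℓ i ≡ just (d , e) × Shape (suc ℓ) (2 ℕ.* i) d × Shape (suc ℓ) (suc (2 ℕ.* i)) e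

levelInvariant-0 : LevelInvariant 0
levelInvariant-0 zero          _              = 1ℚ , refl , record
  { at-one = λ () ; at-middle = λ () ; elsewhere = λ _ _ → unit-1 }
levelInvariant-0 (suc zero)    _              = 1ℚ , refl , record
  { at-one = λ () ; at-middle = λ () ; elsewhere = λ _ _ → unit-1 }
levelInvariant-0 (suc (suc j)) (s≤s (s≤s ()))

pairsInvariant : ∀ {ℓ} → LevelInvariant ℓ → PairsInvariant ℓ
pairsInvariant {ℓ} _ zero _ =
  1ℚ , 2ℚ , refl , shape-even ((λ 0≡2^ℓ → ⊥-elim (2^ℓ≢0 ℓ (sym 0≡2^ℓ))) , λ _ → unit-1) , shape-one
pairsInvariant {ℓ} level (suc i) i+1<2^ℓ⁺¹
  with pairsInvariant level i (ℕ.<-trans (ℕ.n<1+n i) i+1<2^ℓ⁺¹) | level (suc i) i+1<2^ℓ⁺¹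
... | d , e , pairs≡ , _ , se | c , v≡ , sc with safeDiv-just (- c) (shape⇒≢0 se)
... | d′ , safeDiv≡ , d′e≡-c = d′ , _ , pairs-suc i+1<2^ℓ⁺¹ pairs≡ v≡ safeDiv≡ ,
      shape-even sd′ , shape-odd (λ ()) (pairShape-alternating {ℓ} (suc i) sd′)
  where
  sd′ : PairShape ℓ (suc i) d′
  sd′ = pairShape-quotient i+1<2^ℓ⁺¹ sc se d′e≡-c

levelInvariant-suc : ∀ {ℓ} → PairsInvariant ℓ → LevelInvariant (suc ℓ)
levelInvariant-suc {ℓ} pairs j j<2^ℓ⁺² with even-or-odd j
... | i , inj₁ refl with pairs i (ℕ.*-cancelˡ-< 2 i (2 ^ suc ℓ) j<2^ℓ⁺²)
...   | d , _ , pairs≡ , sd , _ = d , v-even {ℓ} {i} pairs≡ , sd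
levelInvariant-suc {ℓ} pairs j j<2^ℓ⁺² | i , inj₂ refl
  with pairs i (ℕ.*-cancelˡ-< 2 i (2 ^ suc ℓ) (ℕ.<-trans (ℕ.n<1+n (2 ℕ.* i)) j<2^ℓ⁺²))
...   | _ , e , pairs≡ , _ , se = e , v-odd {ℓ} {i} pairs≡ , se

levelInvariant : ∀ ℓ → LevelInvariant ℓ
levelInvariant zero    = levelInvariant-0
levelInvariant (suc ℓ) = levelInvariant-suc (pairsInvariant (levelInvariant ℓ))

proposition2p1 : (ℓ j : ℕ) → j < 2 ^ suc ℓ →
    Σ ℚ (λ q → (v ℓ j ≡ just q)
      × ((1 ≤ ℓ × j ≡ 1) → ν₂ q ≡ + 1)
      × ((1 ≤ ℓ × (j ≡ 2 ^ ℓ ⊎ j ≡ 2 ^ ℓ ℕ.+ 1)) → ν₂ q ≡ -[1+ 0 ])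
      × (¬ (1 ≤ ℓ × j ≡ 1) → ¬ (1 ≤ ℓ × (j ≡ 2 ^ ℓ ⊎ j ≡ 2 ^ ℓ ℕ.+ 1)) → ν₂ q ≡ + 0)
      × (q ≢ 0ℚ))
proposition2p1 ℓ j j<2^ℓ⁺¹ with levelInvariant ℓ j j<2^ℓ⁺¹
... | q , v≡q , s =
  q , v≡q ,
  (λ one → cong ν₂ (at-one s one)) ,
  (λ mid → ν₂-halfOfUnit (at-middle s mid)) ,
  (λ ¬one ¬mid → ν₂-unit (elsewhere s ¬one ¬mid)) ,
  shape⇒≢0 s
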